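{- Consider an arbitrary network (not necessarily sorting) with $n$ inputs and an arbitrary cell $c$ of it. Let $x\in\{0,1\}^n$ be an input on which we have access to $c$, and let $x'$ be obtained from $x$ by changing one coordinate from $0$ to $1$. If the value of $c$ on $x'$ is $0$, then we have access to $c$ on $x'$. (That is, access to $c$ can be lost by such a change only if $c$ gets value $1$.)
   Context: A network with $n$ inputs and depth $d$ consists of $d+1$ arrays of cells $c_{a,b}$ ($0\le a\le d$, $1\le b\le n$) and $d$ layers of comparators; layer $a$ ($1\le a\le d$) is a partition of $\{1,\dots,n\}$ into sets called comparators. Given values in the input cells $c_{0,1},\dots,c_{0,n}$, for each comparator $I$ of layer $a$ the values in cells $c_{a-1,i}$, $i\in I$, are sorted in non-decreasing order and written into the cells $c_{a,i}$, $i\in I$, in increasing order of $i$; this inductively defines all cell values. For an input $x\in\{0,1\}^n$ and a cell $c$, we say we have access to $c$ on $x$ if $c$ has value $0$ on $x$ and there is an index $i$ with $x_i=0$ such that changing $x_i$ from $0$ to $1$ makes the value of $c$ equal to $1$. -}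

module Defs where

open import Data.Nat using (ℕ; zero; suc; _+_; _≤ᵇ_)
open import Data.Fin using (Fin; zero; suc; toℕ; _≟_)
open import Data.Bool using (Bool; true; false; if_then_else_; _∧_)
open import Data.Vec using (Vec; []; _∷_)
open import Data.Product using (Σ; _×_)
open import Relation.Nullary.Decidable using (⌊_⌋)
open import Relation.Binary.PropositionalEquality using (_≡_)

-- Boolean values: false = 0, true = 1.
-- An input / an array of cell values on n wires.
Word : ℕ → Set
Word n = Fin n → Bool

count : ∀ {n} → (Fin n → Bool) → ℕ
count {zero}  p = 0
count {suc n} p = (if p zero then 1 else 0) + count (λ j → p (suc j))

-- A layer of comparators: a partition of {1..n}, given by a labelling of
-- the wires; the comparators are the (nonempty) fibres of the labelling.
Layer : ℕ → Set
Layer n = Fin n → Fin n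

_∼[_]_ : ∀ {n} → Fin n → Layer n → Fin n → Bool
i ∼[ L ] j = ⌊ L i ≟ L j ⌋

-- Applying a layer to 0/1 values: inside each comparator I the values are
-- sorted non-decreasingly and written in increasing order of index.
-- For 0/1 values with k ones among the m wires of I, this puts 1 exactly on
-- the k largest indices of I, i.e. wire i gets 1 iff
--   #{ j ∈ I : j ≥ i } ≤ #{ j ∈ I : v j = 1 }.
applyLayer : ∀ {n} → Layer n → Word n → Word n
applyLayer L v i =
  count (λ j → (j ∼[ L ] i) ∧ (toℕ i ≤ᵇ toℕ j))
    ≤ᵇ count (λ j → (j ∼[ L ] i) ∧ v j)

Network : ℕ → ℕ → Set
Network n d = Vec (Layer n) d

stage : ∀ {n d} → Network n d → Fin (suc d) → Word n → Word n
stage N        zero    x = x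
stage (L ∷ N)  (suc a) x = stage N a (applyLayer L x)

cellValue : ∀ {n d} → Network n d → Fin (suc d) → Fin n → Word n → Bool
cellValue N a b x = stage N a x b

setOne : ∀ {n} → Word n → Fin n → Word n
setOne x i j = if ⌊ j ≟ i ⌋ then true else x j

Access : ∀ {n d} → Network n d → Fin (suc d) → Fin n → Word n → Set
Access N a b x =
  cellValue N a b x ≡ false ×
  Σ (Fin _) (λ i → x i ≡ false × cellValue N a b (setOne x i) ≡ true)

module Submission where

open import Defs
open import Data.Nat using (ℕ; suc; zero; _≤_; _≤ᵇ_; z≤n; s≤s)
open import Data.Nat.Properties using (≤ᵇ⇒≤; ≤⇒≤ᵇ; ≤-trans; m≤n⇒m≤1+n)
open import Data.Fin using (Fin; zero; suc; toℕ; _≟_)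
open import Data.Bool using (Bool; true; false; T; _∧_)
open import Data.Bool.Properties using (T-≡)
open import Data.Vec using (_∷_)
open import Data.Product using (_,_)
open import Data.Empty using (⊥-elim)
open import Function.Bundles using (Equivalence)
open import Relation.Nullary using (yes; no)
open import Relation.Binary.PropositionalEquality using (_≡_; _≢_; refl; sym; trans; subst)

-- Every comparator network is monotone on 0/1 inputs.  Suppose flipping x j
-- turns c from 0 to 1.  The input obtained from x' = x[i ↦ 1] by also
-- flipping j dominates x[j ↦ 1], so c is 1 there too; and j ≠ i, since c is
-- 0 on x'.  Hence j still witnesses access to c on x'.

infix 4 _≤ʷ_

_≤ʷ_ : ∀ {n} → Word n → Word n → Set
v ≤ʷ w = ∀ j → T (v j) → T (w j)

count-mono : ∀ {n} (p q : Fin n → Bool) → p ≤ʷ q → count p ≤ count q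
count-mono {zero}  p q p≤q = z≤n
count-mono {suc n} p q p≤q with p zero | q zero | p≤q zero
... | false | false | _   = count-mono _ _ (λ j → p≤q (suc j))
... | false | true  | _   = m≤n⇒m≤1+n (count-mono _ _ (λ j → p≤q (suc j)))
... | true  | true  | _   = s≤s (count-mono _ _ (λ j → p≤q (suc j)))
... | true  | false | p₀⇒q₀ = ⊥-elim (p₀⇒q₀ _)

≤ᵇ-weakenʳ : ∀ l {m n} → m ≤ n → T (l ≤ᵇ m) → T (l ≤ᵇ n)
≤ᵇ-weakenʳ l {m} m≤n l≤ᵇm = ≤⇒≤ᵇ (≤-trans (≤ᵇ⇒≤ l m l≤ᵇm) m≤n)

∧-monoʳ : ∀ a {b c} → (T b → T c) → T (a ∧ b) → T (a ∧ c)
∧-monoʳ true b⇒c = b⇒c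

-- A wire of a comparator receives 1 once the comparator holds enough ones,
-- and more ones in the input means at least as many ones in each comparator.
applyLayer-mono : ∀ {n} (L : Layer n) {v w : Word n} →
                  v ≤ʷ w → applyLayer L v ≤ʷ applyLayer L w
applyLayer-mono L v≤w i =
  ≤ᵇ-weakenʳ (count (λ j → (j ∼[ L ] i) ∧ (toℕ i ≤ᵇ toℕ j)))
    (count-mono _ _ (λ j → ∧-monoʳ (j ∼[ L ] i) (v≤w j)))

stage-mono : ∀ {n d} (N : Network n d) (a : Fin (suc d)) {v w : Word n} →
             v ≤ʷ w → stage N a v ≤ʷ stage N a w
stage-mono N       zero    v≤w = v≤w
stage-mono (L ∷ N) (suc a) v≤w = stage-mono N a (applyLayer-mono L v≤w)

setOne-≤ʷ-setOne-setOne : ∀ {n} (x : Word n) (i j : Fin n) →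
                          setOne x j ≤ʷ setOne (setOne x i) j
setOne-≤ʷ-setOne-setOne x i j k xⱼₖ with k ≟ j
... | yes _ = _
... | no _ with k ≟ i
...   | yes _ = _
...   | no _  = xⱼₖ

setOne-other : ∀ {n} (x : Word n) {i j : Fin n} → j ≢ i → setOne x i j ≡ x j
setOne-other x {i} {j} j≢i with j ≟ i
... | yes j≡i = ⊥-elim (j≢i j≡i)
... | no _    = refl

mainTheorem5 : (n d : ℕ) (N : Network n d) (a : Fin (suc d)) (b : Fin n)
    (x : Word n) (i : Fin n) →
    Access N a b x → x i ≡ false →
    cellValue N a b (setOne x i) ≡ false →
    Access N a b (setOne x i)
mainTheorem5 n d N a b x i (_ , j , xⱼ≡0 , cⱼ≡1) _ cᵢ≡0 =
  cᵢ≡0 , j , x′ⱼ≡0 , c′ⱼ≡1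
  where
  open Equivalence
  j≢i : j ≢ i
  j≢i refl = subst T (trans (sym cⱼ≡1) cᵢ≡0) _
  x′ⱼ≡0 : setOne x i j ≡ false
  x′ⱼ≡0 = trans (setOne-other x j≢i) xⱼ≡0
  c′ⱼ≡1 : cellValue N a b (setOne (setOne x i) j) ≡ true
  c′ⱼ≡1 = to T-≡ (stage-mono N a (setOne-≤ʷ-setOne-setOne x i j) b
                                (from T-≡ cⱼ≡1))
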